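{- $\theta_k \leq \binom{n+1}{k+2} a_{k}$.
   Context: Let $X$ be a finite $n$-dimensional pure simplicial complex, $X(k)$ its set of $k$-faces, $f_k(X)=|X(k)|$. For $\sigma\in X(k)$ let $c(\sigma)$ be the number of $n$-faces containing $\sigma$ and $w(\sigma)=\frac{c(\sigma)}{\binom{n+1}{k+1}f_n(X)}$. Homology is with $\mathbb{F}_2$ coefficients. Let $(X,S,G,\mathcal{B})$ be an $n$-dimensional building-like complex: $G\le\mathrm{Aut}(X)$, $S$ a finite $G$-set, $\mathcal{F}_k=S\times X(k)$ ($-1\le k\le n-1$, with $k=-1$ corresponding to the empty simplex) with $G$-action $g(s,\tau)=(gs,g\tau)$, $\mathcal{B}=\{B_{s,\tau}\}$ subcomplexes with $\tau\in B_{s,\tau}\subset B_{s,\tau'}$ for $\tau\subset\tau'$, such that (C1) $G$ is transitive on $X(n)$, (C2) $gB_{s,\tau}=B_{gs,g\tau}$, (C3) $\tilde H_i(B_{s,\tau})=0$ for $(s,\tau)\in\mathcal{F}_k$, $-1\le i\le k<n$. Let $\mathcal{C}=\{c_{s,\tau}\in C_{k+1}(B_{s,\tau})\}$ be a family of chains satisfying $\partial_{k+1}c_{s,\tau}=\tau+\sum_{i=0}^k c_{s,\tau_i}$ ($\tau_i$ is $\tau$ with its $i$-th vertex removed). For $\eta\in X(k+1)$ let $\lambda(\eta)=\frac{1}{|S|w(\eta)}\sum_{\{(s,\tau)\in\mathcal{F}_k:\eta\in\mathrm{supp}(c_{s,\tau})\}}w(\tau)$ and $\theta_k=\max_{\eta\in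 X(k+1)}\lambda(\eta)$, with $0\le k\le n-1$. Also $a_k=\max\{|G\eta\cap B_{s,\tau}(k+1)|:\eta\in X(k+1),(s,\tau)\in\mathcal{F}_k\}$. -}

module Defs where

open import Data.Nat as ℕ using (ℕ; zero; suc; _+_; _*_; _≤_; _<_; _≡ᵇ_)
open import Data.Nat.Combinatorics using (_C_)
open import Data.Bool as Bool using (Bool; true; false; _xor_; not; _∧_)
open import Data.Fin using (Fin)
open import Data.Fin.Subset using (Subset; _⊆_; ∣_∣; ⁅_⁆; _∪_; _-_; inside; outside)
open import Data.Fin.Subset.Properties using (_⊆?_)
open import Data.Vec as Vec using (Vec; []; _∷_; tabulate; lookup)
open import Data.Vec.Properties using (≡-dec)
open import Data.List as List using (List; map; filterᵇ; length; foldr; allFin; concatMap; _++_)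
open import Data.List.Membership.Propositional using (_∈_)
open import Data.Integer using (+_)
open import Data.Rational as ℚ using (ℚ; 0ℚ; _÷_; ≢-nonZero)
open import Data.Product using (Σ; _×_; ∃)
open import Relation.Nullary.Decidable using (does; yes; no)
open import Relation.Binary.PropositionalEquality using (_≡_)
open import Algebra.Structures using (IsGroup)
open import Data.Bool.ListAction using (any)

-- A simplex is a subset of the vertices; a k-simplex
-- has k+1 elements (the empty subset is the (-1)-simplex ∅).
-- A complex (or any set of simplices) is a Bool-valued predicate on
-- subsets; an F₂-chain is likewise a Bool-valued function (its support).

Complex : ℕ → Set
Complex V = Subset V → Bool

Chain : ℕ → Set
Chain V = Subset V → Bool

allSubsets : (V : ℕ) → List (Subset V)
allSubsets zero    = [] List.∷ List.[]
allSubsets (suc V) = map (outside ∷_) (allSubsets V) ++ map (inside ∷_) (allSubsets V)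

-- the faces of K with exactly j vertices (i.e. K(j-1))
facesOfSize : ∀ {V} → Complex V → ℕ → List (Subset V)
facesOfSize {V} K j = filterᵇ (λ σ → K σ ∧ (∣ σ ∣ ≡ᵇ j)) (allSubsets V)

_⊆ᵇ_ : ∀ {V} → Subset V → Subset V → Bool
σ ⊆ᵇ τ = does (σ ⊆? τ)

_≟ˢ_ : ∀ {V} → Subset V → Subset V → Bool
σ ≟ˢ τ = does (≡-dec Bool._≟_ σ τ)

parity : List Bool → Bool
parity = foldr _xor_ false

IsComplex : ∀ {V} → Complex V → Set
IsComplex K = ∀ σ τ → σ ⊆ τ → K τ ≡ true → K σ ≡ true

IsSubcomplex : ∀ {V} → Complex V → Complex V → Set
IsSubcomplex K X = IsComplex K × (∀ σ → K σ ≡ true → X σ ≡ true)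

IsPure : ∀ {V} → Complex V → ℕ → Set
IsPure X n =
  IsComplex X
  × Σ _ (λ ρ → X ρ ≡ true × ∣ ρ ∣ ≡ suc n)
  × (∀ σ → X σ ≡ true → Σ _ (λ ρ → X ρ ≡ true × ∣ ρ ∣ ≡ suc n × σ ⊆ ρ))

-- Boundary over F₂ of the augmented (reduced) chain complex:
-- (∂c)(σ) = Σ_{v ∉ σ} c(σ ∪ {v})  (mod 2).  For a 0-chain this gives the
-- augmentation (coefficient of ∅).
∂ : ∀ {V} → Chain V → Chain V
∂ {V} c σ = parity (map (λ v → not (lookup σ v) ∧ c (σ ∪ ⁅ v ⁆)) (allFin V))

-- c is a chain of K of dimension j-1 (supported on faces of K with j vertices)
IsChainOf : ∀ {V} → Complex V → ℕ → Chain V → Set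
IsChainOf K j c = ∀ σ → c σ ≡ true → K σ ≡ true × ∣ σ ∣ ≡ j

-- Reduced homology H̃_{j-1}(K; F₂) vanishes (j = 0 is H̃_{-1}).
ReducedHomologyVanishes : ∀ {V} → Complex V → ℕ → Set
ReducedHomologyVanishes K j =
  ∀ z → IsChainOf K j z → (∀ σ → ∂ z σ ≡ false) →
  Σ _ (λ y → IsChainOf K (suc j) y × (∀ σ → ∂ y σ ≡ z σ))

record FinGroup : Set₁ where
  infixl 7 _∙_
  field
    Carrier : Set
    _∙_     : Carrier → Carrier → Carrier
    ε       : Carrier
    _⁻¹     : Carrier → Carrier
    isGroup : IsGroup _≡_ _∙_ ε _⁻¹
    elems   : List Carrier
    complete : ∀ g → g ∈ elems

module _ (G : FinGroup) where
  open FinGroup G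

  IsAction : (m : ℕ) → (Carrier → Fin m → Fin m) → Set
  IsAction m act = (∀ x → act ε x ≡ x) × (∀ g h x → act (g ∙ h) x ≡ act g (act h x))

  -- induced action on simplices: gσ = { g v | v ∈ σ }
  actSub : ∀ {V} → (Carrier → Fin V → Fin V) → Carrier → Subset V → Subset V
  actSub act g σ = tabulate (λ w → lookup σ (act (g ⁻¹) w))

  IsAutSubgroup : ∀ {V} → Complex V → (Carrier → Fin V → Fin V) → Set
  IsAutSubgroup {V} X act =
    IsAction V act
    × (∀ g → (∀ v → act g v ≡ v) → g ≡ ε)
    × (∀ g σ → X (actSub act g σ) ≡ X σ)

  inOrbit : ∀ {V} → (Carrier → Fin V → Fin V) → Subset V → Subset V → Bool
  inOrbit act η η' = any (λ g → actSub act g η ≟ˢ η') elems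

-- Building-like complexes (X, S, G, B), with S = Fin m.
-- (s, τ) ∈ 𝓕_k iff τ ∈ X and ∣τ∣ = k+1, -1 ≤ k ≤ n-1; i.e. ∣τ∣ ≤ n.

IsBuildingLike : ∀ {V} (X : Complex V) (n : ℕ) (G : FinGroup)
  (act : FinGroup.Carrier G → Fin V → Fin V)
  (m : ℕ) (actS : FinGroup.Carrier G → Fin m → Fin m)
  (B : Fin m → Subset V → Complex V) → Set
IsBuildingLike {V} X n G act m actS B =
  IsPure X n
  × IsAutSubgroup G X act
  × IsAction G m actS
  × (∀ s τ → X τ ≡ true → ∣ τ ∣ ≤ n → IsSubcomplex (B s τ) X × B s τ τ ≡ true)
  × (∀ s τ τ' → X τ' ≡ true → ∣ τ' ∣ ≤ n → τ ⊆ τ' →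
       ∀ σ → B s τ σ ≡ true → B s τ' σ ≡ true)
  -- (C1) G transitive on X(n)
  × (∀ ρ ρ' → X ρ ≡ true → ∣ ρ ∣ ≡ suc n → X ρ' ≡ true → ∣ ρ' ∣ ≡ suc n →
       Σ (FinGroup.Carrier G) (λ g → actSub G act g ρ ≡ ρ'))
  -- (C2) g B_{s,τ} = B_{gs,gτ}
  × (∀ g s τ σ → X τ ≡ true → ∣ τ ∣ ≤ n →
       B (actS g s) (actSub G act g τ) (actSub G act g σ) ≡ B s τ σ)
  -- (C3) H̃_i(B_{s,τ}) = 0 for -1 ≤ i ≤ k, where ∣τ∣ = k+1
  × (∀ s τ → X τ ≡ true → ∣ τ ∣ ≤ n →
       ∀ j → j ≤ ∣ τ ∣ → ReducedHomologyVanishes (B s τ) j)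

IsChainFamily : ∀ {V} (X : Complex V) (n m : ℕ)
  (B : Fin m → Subset V → Complex V) (c : Fin m → Subset V → Chain V) → Set
IsChainFamily {V} X n m B c =
  ∀ s τ → X τ ≡ true → ∣ τ ∣ ≤ n →
    IsChainOf (B s τ) (suc ∣ τ ∣) (c s τ)
    × (∀ σ → ∂ (c s τ) σ ≡
         ((σ ≟ˢ τ) xor parity (map (λ v → lookup τ v ∧ c s (τ - v) σ) (allFin V))))

-- total division on ℚ-valued fractions (denominators are nonzero in use)
fracℕ : ℕ → ℕ → ℚ
fracℕ a zero    = 0ℚ
fracℕ a (suc d) = (+ a) ℚ./ suc d

divℚ : ℚ → ℚ → ℚ
divℚ p q with q ℚ.≟ 0ℚ
... | yes _  = 0ℚ
... | no q≢0 = _÷_ p q {{≢-nonZero q≢0}}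

sumℚ : List ℚ → ℚ
sumℚ = foldr ℚ._+_ 0ℚ

maxℚ : List ℚ → ℚ
maxℚ = foldr ℚ._⊔_ 0ℚ

maxℕ : List ℕ → ℕ
maxℕ = foldr ℕ._⊔_ 0

module Weights {V : ℕ} (X : Complex V) (n : ℕ) where
  fₙ : ℕ
  fₙ = length (facesOfSize X (suc n))

  cnt : Subset V → ℕ
  cnt σ = length (filterᵇ (λ ρ → σ ⊆ᵇ ρ) (facesOfSize X (suc n)))

  w : Subset V → ℚ
  w σ = fracℕ (cnt σ) ((suc n C ∣ σ ∣) * fₙ)

  module _ (m : ℕ) (c : Fin m → Subset V → Chain V) (k : ℕ) where
    lam : Subset V → ℚ
    lam η = divℚ
      (sumℚ (concatMap (λ s → map w (filterᵇ (λ τ → c s τ η) (facesOfSize X (suc k))))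
                       (allFin m)))
      (fracℕ m 1 ℚ.* w η)

    θ : ℚ
    θ = maxℚ (map lam (facesOfSize X (suc (suc k))))

  aₖ : (G : FinGroup) (act : FinGroup.Carrier G → Fin V → Fin V)
       (m : ℕ) (B : Fin m → Subset V → Complex V) (k : ℕ) → ℕ
  aₖ G act m B k =
    maxℕ (concatMap (λ η → concatMap (λ s → map (λ τ →
            length (filterᵇ (inOrbit G act η) (facesOfSize (B s τ) (suc (suc k)))))
            (facesOfSize X (suc k))) (allFin m))
          (facesOfSize X (suc (suc k))))

-- Clearing denominators, λ(η) ≤ C(n+1,k+2)·a_k becomes
--   Σ_{(s,τ) : η ∈ supp c_{s,τ}} c(τ) ≤ |S|·a_k·C(n+1,k+1)·c(η),
-- where c(σ) is the number of n-faces containing σ. Enlarge the left side to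
-- W(η) = Σ_{(s,τ) : η ∈ B_{s,τ}} c(τ), which by (C2) is constant on the orbit Gη.
-- Summing W over Gη and exchanging the sums gives
--   |Gη|·W(η) = Σ_{s,τ} c(τ)·|Gη ∩ B_{s,τ}(k+1)|
--             ≤ |S|·a_k·Σ_{τ ∈ X(k)} c(τ) = |S|·a_k·C(n+1,k+1)·f_n,
-- while by (C1) every n-face contains a translate of η, so f_n ≤ |Gη|·c(η).
-- Cancelling |Gη| gives the claim. Only (C1), (C2) and supp c_{s,τ} ⊆ B_{s,τ} are used.

module Submission where

open import Defs
open import Data.Nat using (ℕ; _<_; _*_; suc)
open import Data.Nat.Combinatorics using (_C_)
open import Data.Fin using (Fin)
import Data.Fin as Fin
open import Data.Fin.Subset using (Subset)
open import Data.Rational using (_≤_)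

open import Data.Nat as ℕ using (zero; _+_; z≤n; _≡ᵇ_)
import Data.Nat.Properties as ℕP
open import Data.Nat.Combinatorics using (nCk+nC[k+1]≡[n+1]C[k+1])
open import Data.Bool as Bool using (Bool; true; false; _∧_)
import Data.Integer as ℤ
import Data.Integer.Properties as ℤP
open import Data.Rational as ℚ using (ℚ; 0ℚ; _÷_; toℚᵘ)
import Data.Rational.Properties as ℚP
open import Data.Rational.Unnormalised as ℚᵘ using (mkℚᵘ; *≡*; *≤*)
import Data.Rational.Unnormalised.Properties as ℚᵘP
open import Data.List using (List; []; _∷_; map; filterᵇ; length; allFin; concatMap; _++_; tabulate)
open import Data.List.Membership.Propositional using (_∈_)
import Data.List.Membership.Propositional.Properties as ∈P
open import Data.List.Properties using (length-tabulate)
open import Data.List.Relation.Unary.Any as Any using (here; there)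
import Data.List.Relation.Unary.Any.Properties as AnyP
open import Data.Bool.Properties using (T-≡; ∧-identityʳ)
open import Data.Product using (Σ; _×_; _,_; proj₁; proj₂)
open import Data.Vec using ([]; _∷_; lookup; _[_]=_)
open import Data.Fin.Subset using (∣_∣; _⊆_; inside; outside)
open import Data.Fin.Subset.Properties using (_⊆?_)
open import Algebra.Structures using (IsGroup)
import Data.Fin.Properties as FinP
import Data.Vec.Properties as VecP
open import Function using (_∘_; _⇔_; mk⇔; Equivalence)
open import Level using (Level)
open import Relation.Binary.Definitions using (DecidableEquality)
open import Relation.Binary.PropositionalEquality hiding ([_])
open import Relation.Nullary.Decidable using (does; yes; no; does-⇔; dec-true)
open import Data.Nat.Tactic.RingSolver using (solve-∀)
open import Algebra.Properties.CommutativeSemigroup ℕP.+-commutativeSemigroup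
  using () renaming (interchange to +-interchange)

private variable
  a b : Level
  A : Set a
  B : Set b

infixr 8 [_]*_
infix 5 ∑

[_]*_ : Bool → ℕ → ℕ
[ true  ]* n = n
[ false ]* n = 0

∑ : List A → (A → ℕ) → ℕ
∑ []       f = 0
∑ (x ∷ xs) f = f x + ∑ xs f

syntax ∑ xs (λ x → e) = ∑[ x ← xs ] e

[]*-≤ : ∀ b n → [ b ]* n ℕ.≤ n
[]*-≤ true  n = ℕP.≤-refl
[]*-≤ false n = z≤n

[]*-mono-⇒ : ∀ {b c} n → (b ≡ true → c ≡ true) → [ b ]* n ℕ.≤ [ c ]* n
[]*-mono-⇒ {false} n b⇒c = z≤n
[]*-mono-⇒ {true}  n b⇒c rewrite b⇒c refl = ℕP.≤-refl

[]*-0 : ∀ b → [ b ]* 0 ≡ 0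
[]*-0 true  = refl
[]*-0 false = refl

[]*-∧ : ∀ b c n → [ b ∧ c ]* n ≡ [ b ]* [ c ]* n
[]*-∧ true  c n = refl
[]*-∧ false c n = refl

[]*-comm : ∀ b c n → [ b ]* [ c ]* n ≡ [ c ]* [ b ]* n
[]*-comm true  c     n = refl
[]*-comm false true  n = refl
[]*-comm false false n = refl

[]*-*ˡ : ∀ b m n → [ b ]* (m * n) ≡ m * [ b ]* n
[]*-*ˡ true  m n = refl
[]*-*ˡ false m n = sym (ℕP.*-zeroʳ m)

[]*1-*ʳ : ∀ b n → [ b ]* n ≡ n * [ b ]* 1
[]*1-*ʳ true  n = sym (ℕP.*-identityʳ n)
[]*1-*ʳ false n = sym (ℕP.*-zeroʳ n)

∑-cong : ∀ (xs : List A) {f g : A → ℕ} → (∀ x → f x ≡ g x) → ∑ xs f ≡ ∑ xs g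
∑-cong []       f≗g = refl
∑-cong (x ∷ xs) f≗g = cong₂ _+_ (f≗g x) (∑-cong xs f≗g)

∑-mono : ∀ (xs : List A) {f g : A → ℕ} → (∀ x → f x ℕ.≤ g x) → ∑ xs f ℕ.≤ ∑ xs g
∑-mono []       f≤g = z≤n
∑-mono (x ∷ xs) f≤g = ℕP.+-mono-≤ (f≤g x) (∑-mono xs f≤g)

∑-0 : ∀ (xs : List A) → ∑[ x ← xs ] 0 ≡ 0
∑-0 []       = refl
∑-0 (x ∷ xs) = ∑-0 xs

∑-const : ∀ (xs : List A) n → ∑[ x ← xs ] n ≡ length xs * n
∑-const []       n = refl
∑-const (x ∷ xs) n = cong (n +_) (∑-const xs n)

∑-+ : ∀ (xs : List A) (f g : A → ℕ) → ∑[ x ← xs ] (f x + g x) ≡ ∑ xs f + ∑ xs g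
∑-+ []       f g = refl
∑-+ (x ∷ xs) f g =
  trans (cong (f x + g x +_) (∑-+ xs f g)) (+-interchange (f x) (g x) (∑ xs f) (∑ xs g))

∑-*ˡ : ∀ (xs : List A) m (f : A → ℕ) → ∑[ x ← xs ] (m * f x) ≡ m * ∑ xs f
∑-*ˡ []       m f = sym (ℕP.*-zeroʳ m)
∑-*ˡ (x ∷ xs) m f = trans (cong (m * f x +_) (∑-*ˡ xs m f)) (sym (ℕP.*-distribˡ-+ m (f x) _))

[]*-∑ : ∀ b (xs : List A) (f : A → ℕ) → [ b ]* ∑ xs f ≡ ∑[ x ← xs ] [ b ]* f x
[]*-∑ true  xs f = refl
[]*-∑ false xs f = sym (∑-0 xs)

∑-++ : ∀ (xs ys : List A) (f : A → ℕ) → ∑ (xs ++ ys) f ≡ ∑ xs f + ∑ ys f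
∑-++ []       ys f = refl
∑-++ (x ∷ xs) ys f = trans (cong (f x +_) (∑-++ xs ys f)) (sym (ℕP.+-assoc (f x) _ _))

∑-map : ∀ (g : B → A) (xs : List B) (f : A → ℕ) → ∑ (map g xs) f ≡ ∑ xs (f ∘ g)
∑-map g []       f = refl
∑-map g (x ∷ xs) f = cong (f (g x) +_) (∑-map g xs f)

∑-filterᵇ : ∀ (p : A → Bool) xs (f : A → ℕ) → ∑ (filterᵇ p xs) f ≡ ∑[ x ← xs ] [ p x ]* f x
∑-filterᵇ p []       f = refl
∑-filterᵇ p (x ∷ xs) f with p x
... | true  = cong (f x +_) (∑-filterᵇ p xs f)
... | false = ∑-filterᵇ p xs f

length-filterᵇ : ∀ (p : A → Bool) xs → length (filterᵇ p xs) ≡ ∑[ x ← xs ] [ p x ]* 1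
length-filterᵇ p xs = trans (sym (ℕP.*-identityʳ _))
  (trans (sym (∑-const (filterᵇ p xs) 1)) (∑-filterᵇ p xs (λ _ → 1)))

∑-∈ : ∀ {xs : List A} {x} (f : A → ℕ) → x ∈ xs → f x ℕ.≤ ∑ xs f
∑-∈ f (here refl)            = ℕP.m≤m+n _ _
∑-∈ {xs = y ∷ _} f (there p) = ℕP.≤-trans (∑-∈ f p) (ℕP.m≤n+m _ (f y))

∑-comm : ∀ (xs : List A) (ys : List B) (f : A → B → ℕ) →
  ∑[ x ← xs ] ∑[ y ← ys ] f x y ≡ ∑[ y ← ys ] ∑[ x ← xs ] f x y
∑-comm []       ys f = sym (∑-0 ys)
∑-comm (x ∷ xs) ys f =
  trans (cong (∑ ys (f x) +_) (∑-comm xs ys f)) (sym (∑-+ ys (f x) _))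

∑-comm-[]* : ∀ (xs : List A) (ys : List B) (p : A → Bool) (q : B → Bool) (f : A → B → ℕ) →
  ∑[ x ← xs ] [ p x ]* (∑[ y ← ys ] [ q y ]* f x y) ≡ ∑[ y ← ys ] [ q y ]* (∑[ x ← xs ] [ p x ]* f x y)
∑-comm-[]* xs ys p q f = begin
  ∑[ x ← xs ] [ p x ]* (∑[ y ← ys ] [ q y ]* f x y) ≡⟨ ∑-cong xs (λ x → []*-∑ (p x) ys _) ⟩
  ∑[ x ← xs ] ∑[ y ← ys ] [ p x ]* [ q y ]* f x y   ≡⟨ ∑-comm xs ys _ ⟩
  ∑[ y ← ys ] ∑[ x ← xs ] [ p x ]* [ q y ]* f x y   ≡⟨ ∑-cong ys (λ y → ∑-cong xs (λ x → []*-comm (p x) (q y) _)) ⟩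
  ∑[ y ← ys ] ∑[ x ← xs ] [ q y ]* [ p x ]* f x y   ≡⟨ ∑-cong ys (λ y → []*-∑ (q y) xs _) ⟨
  ∑[ y ← ys ] [ q y ]* (∑[ x ← xs ] [ p x ]* f x y) ∎
  where open ≡-Reasoning

∑-tabulate : ∀ {n} (f : Fin n → A) (h : A → ℕ) → ∑ (tabulate f) h ≡ ∑[ i ← allFin n ] h (f i)
∑-tabulate {n = zero}  f h = refl
∑-tabulate {n = suc n} f h =
  cong (h (f Fin.zero) +_) (trans (∑-tabulate (f ∘ Fin.suc) h) (sym (∑-tabulate Fin.suc (h ∘ f))))

record Enumeration (A : Set) : Set where
  field
    elements    : List A
    _≟_         : DecidableEquality A
    occurs-once : ∀ y → ∑[ x ← elements ] [ does (x ≟ y) ]* 1 ≡ 1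

  ∑-pick : ∀ z (h : A → ℕ) → ∑[ y ← elements ] [ does (y ≟ z) ]* h y ≡ h z
  ∑-pick z h = begin
    ∑[ y ← elements ] [ does (y ≟ z) ]* h y       ≡⟨ ∑-cong elements scale ⟩
    ∑[ y ← elements ] h z * [ does (y ≟ z) ]* 1   ≡⟨ ∑-*ˡ elements (h z) _ ⟩
    h z * (∑[ y ← elements ] [ does (y ≟ z) ]* 1) ≡⟨ cong (h z *_) (occurs-once z) ⟩
    h z * 1                                        ≡⟨ ℕP.*-identityʳ (h z) ⟩
    h z                                            ∎
    where
    open ≡-Reasoning
    scale : ∀ y → [ does (y ≟ z) ]* h y ≡ h z * [ does (y ≟ z) ]* 1
    scale y with y ≟ z
    ... | yes refl = sym (ℕP.*-identityʳ (h y))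
    ... | no _     = sym (ℕP.*-zeroʳ (h z))

  ∑-reindex : (f f⁻¹ : A → A) → (∀ x → f⁻¹ (f x) ≡ x) → (∀ y → f (f⁻¹ y) ≡ y) →
              (h : A → ℕ) → ∑[ x ← elements ] h (f x) ≡ ∑ elements h
  ∑-reindex f f⁻¹ f⁻¹∘f f∘f⁻¹ h = begin
    ∑[ x ← elements ] h (f x)
      ≡⟨ ∑-cong elements (λ x → sym (∑-pick (f x) h)) ⟩
    ∑[ x ← elements ] ∑[ y ← elements ] [ does (y ≟ f x) ]* h y
      ≡⟨ ∑-comm elements elements _ ⟩
    ∑[ y ← elements ] ∑[ x ← elements ] [ does (y ≟ f x) ]* h y
      ≡⟨ ∑-cong elements (λ y → ∑-cong elements (λ x →
           cong ([_]* h y) (does-⇔ (swap x y) (y ≟ f x) (x ≟ f⁻¹ y)))) ⟩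
    ∑[ y ← elements ] ∑[ x ← elements ] [ does (x ≟ f⁻¹ y) ]* h y
      ≡⟨ ∑-cong elements (λ y → ∑-pick (f⁻¹ y) (λ _ → h y)) ⟩
    ∑ elements h ∎
    where
    open ≡-Reasoning
    swap : ∀ x y → (y ≡ f x) ⇔ (x ≡ f⁻¹ y)
    swap x y = mk⇔ (λ { refl → sym (f⁻¹∘f x) }) (λ { refl → sym (f∘f⁻¹ y) })

finEnumeration : ∀ n → Enumeration (Fin n)
finEnumeration n = record { elements = allFin n ; _≟_ = FinP._≟_ ; occurs-once = once }
  where
  once : ∀ {n} (y : Fin n) → ∑[ x ← allFin n ] [ does (x FinP.≟ y) ]* 1 ≡ 1
  once {suc n} Fin.zero    =
    cong suc (trans (∑-tabulate {n = n} Fin.suc (λ x → [ does (x FinP.≟ Fin.zero) ]* 1)) (∑-0 (allFin n)))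
  once {suc n} (Fin.suc y) =
    trans (∑-tabulate {n = n} Fin.suc (λ x → [ does (x FinP.≟ Fin.suc y) ]* 1)) (once y)

allSubsets-complete : ∀ {V} (σ : Subset V) → σ ∈ allSubsets V
allSubsets-complete []              = here refl
allSubsets-complete {suc V} (false ∷ σ) =
  ∈P.∈-++⁺ˡ (∈P.∈-map⁺ (outside ∷_) (allSubsets-complete σ))
allSubsets-complete {suc V} (true ∷ σ) =
  ∈P.∈-++⁺ʳ (map (outside ∷_) (allSubsets V)) (∈P.∈-map⁺ (inside ∷_) (allSubsets-complete σ))

∑-allSubsets-suc : ∀ {V} (h : Subset (suc V) → ℕ) →
  ∑ (allSubsets (suc V)) h ≡ ∑ (allSubsets V) (h ∘ (outside ∷_)) + ∑ (allSubsets V) (h ∘ (inside ∷_))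
∑-allSubsets-suc {V} h = trans (∑-++ (map (outside ∷_) (allSubsets V)) _ h)
  (cong₂ _+_ (∑-map (outside ∷_) (allSubsets V) h) (∑-map (inside ∷_) (allSubsets V) h))

subsetEnumeration : ∀ V → Enumeration (Subset V)
subsetEnumeration V = record { elements = allSubsets V ; _≟_ = VecP.≡-dec Bool._≟_ ; occurs-once = once }
  where
  once : ∀ {V} (τ : Subset V) → ∑[ σ ← allSubsets V ] [ σ ≟ˢ τ ]* 1 ≡ 1
  once []              = refl
  once {suc V} (false ∷ τ) = trans (∑-allSubsets-suc (λ σ → [ σ ≟ˢ (false ∷ τ) ]* 1))
    (cong₂ _+_ (once τ) (∑-0 (allSubsets V)))
  once {suc V} (true ∷ τ)  = trans (∑-allSubsets-suc (λ σ → [ σ ≟ˢ (true ∷ τ) ]* 1))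
    (cong₂ _+_ (∑-0 (allSubsets V)) (once τ))

∣_∣≡∑ : ∀ {V} (σ : Subset V) → ∣ σ ∣ ≡ ∑[ v ← allFin V ] [ lookup σ v ]* 1
∣ [] ∣≡∑ = refl
∣_∣≡∑ {suc V} (true ∷ σ)  =
  cong suc (trans ∣ σ ∣≡∑ (sym (∑-tabulate Fin.suc (λ v → [ lookup (true ∷ σ) v ]* 1))))
∣_∣≡∑ {suc V} (false ∷ σ) =
  trans ∣ σ ∣≡∑ (sym (∑-tabulate Fin.suc (λ v → [ lookup (false ∷ σ) v ]* 1)))

∑-subsets-of-size : ∀ {V} (ρ : Subset V) j →
  ∑[ τ ← allSubsets V ] [ ∣ τ ∣ ≡ᵇ j ]* [ τ ⊆ᵇ ρ ]* 1 ≡ ∣ ρ ∣ C j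
∑-subsets-of-size [] zero    = refl
∑-subsets-of-size [] (suc j) = refl
∑-subsets-of-size {suc V} (false ∷ ρ) j =
  trans (∑-allSubsets-suc (λ τ → [ ∣ τ ∣ ≡ᵇ j ]* [ τ ⊆ᵇ (false ∷ ρ) ]* 1))
    (trans (cong₂ _+_ (∑-subsets-of-size ρ j)
                      (trans (∑-cong (allSubsets V) (λ τ → []*-0 _)) (∑-0 (allSubsets V))))
      (ℕP.+-identityʳ _))
∑-subsets-of-size {suc V} (true ∷ ρ) zero =
  trans (∑-allSubsets-suc (λ τ → [ ∣ τ ∣ ≡ᵇ 0 ]* [ τ ⊆ᵇ (true ∷ ρ) ]* 1))
    (cong₂ _+_ (∑-subsets-of-size ρ 0) (∑-0 (allSubsets V)))
∑-subsets-of-size {suc V} (true ∷ ρ) (suc j) =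
  trans (∑-allSubsets-suc (λ τ → [ ∣ τ ∣ ≡ᵇ suc j ]* [ τ ⊆ᵇ (true ∷ ρ) ]* 1))
    (trans (cong₂ _+_ (∑-subsets-of-size ρ (suc j)) (∑-subsets-of-size ρ j))
      (trans (ℕP.+-comm (∣ ρ ∣ C suc j) (∣ ρ ∣ C j)) (nCk+nC[k+1]≡[n+1]C[k+1] ∣ ρ ∣ j)))

toℚᵘ-fracℕ : ∀ a d → toℚᵘ (fracℕ a (suc d)) ℚᵘ.≃ mkℚᵘ (ℤ.+ a) d
toℚᵘ-fracℕ a d = ℚP.toℚᵘ-fromℚᵘ (mkℚᵘ (ℤ.+ a) d)

fracℕ-0 : ∀ D → fracℕ 0 D ≡ 0ℚ
fracℕ-0 zero    = refl
fracℕ-0 (suc d) = ℚP.toℚᵘ-injective (ℚᵘP.≃-trans (toℚᵘ-fracℕ 0 d) (*≡* refl))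

0≤fracℕ : ∀ a D → 0ℚ ≤ fracℕ a D
0≤fracℕ a zero    = ℚP.≤-refl
0≤fracℕ a (suc d) = ℚP.nonNegative⁻¹ _ {{ℚP.normalize-nonNeg a (suc d)}}

fracℕ-mono : ∀ a b D d' → a * suc d' ℕ.≤ b * D → fracℕ a D ≤ fracℕ b (suc d')
fracℕ-mono a b zero    d' _ = 0≤fracℕ b (suc d')
fracℕ-mono a b (suc d) d' h = ℚP.toℚᵘ-cancel-≤
  (ℚᵘP.≤-respʳ-≃ (ℚᵘP.≃-sym (toℚᵘ-fracℕ b d'))
    (ℚᵘP.≤-respˡ-≃ (ℚᵘP.≃-sym (toℚᵘ-fracℕ a d))
      (*≤* (subst₂ ℤ._≤_ (ℤP.pos-* a (suc d')) (ℤP.pos-* b (suc d)) (ℤ.+≤+ h)))))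

fracℕ-+ : ∀ a b D → fracℕ a D ℚ.+ fracℕ b D ≡ fracℕ (a + b) D
fracℕ-+ a b zero    = refl
fracℕ-+ a b (suc d) = ℚP.toℚᵘ-injective (begin
  toℚᵘ (fracℕ a (suc d) ℚ.+ fracℕ b (suc d))
    ≈⟨ ℚP.toℚᵘ-homo-+ (fracℕ a (suc d)) (fracℕ b (suc d)) ⟩
  toℚᵘ (fracℕ a (suc d)) ℚᵘ.+ toℚᵘ (fracℕ b (suc d))
    ≈⟨ ℚᵘP.+-cong (toℚᵘ-fracℕ a d) (toℚᵘ-fracℕ b d) ⟩
  mkℚᵘ (ℤ.+ a) d ℚᵘ.+ mkℚᵘ (ℤ.+ b) d
    ≈⟨ *≡* cross ⟩
  mkℚᵘ (ℤ.+ (a + b)) d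
    ≈⟨ toℚᵘ-fracℕ (a + b) d ⟨
  toℚᵘ (fracℕ (a + b) (suc d)) ∎)
  where
  open ℚᵘP.≃-Reasoning
  S = suc d
  cross : (ℤ.+ a ℤ.* ℤ.+ S ℤ.+ ℤ.+ b ℤ.* ℤ.+ S) ℤ.* ℤ.+ S ≡ ℤ.+ (a + b) ℤ.* ℤ.+ (S * S)
  cross = trans (cong (ℤ._* ℤ.+ S) (sym (ℤP.*-distribʳ-+ (ℤ.+ S) (ℤ.+ a) (ℤ.+ b))))
    (trans (ℤP.*-assoc (ℤ.+ a ℤ.+ ℤ.+ b) (ℤ.+ S) (ℤ.+ S))
      (sym (cong₂ ℤ._*_ (ℤP.pos-+ a b) (ℤP.pos-* S S))))

fracℕ-*ˡ : ∀ a b D → fracℕ a 1 ℚ.* fracℕ b D ≡ fracℕ (a * b) D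
fracℕ-*ˡ a b zero    = ℚP.*-zeroʳ (fracℕ a 1)
fracℕ-*ˡ a b (suc d) = ℚP.toℚᵘ-injective (begin
  toℚᵘ (fracℕ a 1 ℚ.* fracℕ b (suc d))
    ≈⟨ ℚP.toℚᵘ-homo-* (fracℕ a 1) (fracℕ b (suc d)) ⟩
  toℚᵘ (fracℕ a 1) ℚᵘ.* toℚᵘ (fracℕ b (suc d))
    ≈⟨ ℚᵘP.*-cong (toℚᵘ-fracℕ a 0) (toℚᵘ-fracℕ b d) ⟩
  mkℚᵘ (ℤ.+ a) 0 ℚᵘ.* mkℚᵘ (ℤ.+ b) d
    ≈⟨ *≡* cross ⟨
  mkℚᵘ (ℤ.+ (a * b)) d
    ≈⟨ toℚᵘ-fracℕ (a * b) d ⟨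
  toℚᵘ (fracℕ (a * b) (suc d)) ∎)
  where
  open ℚᵘP.≃-Reasoning
  cross : ℤ.+ (a * b) ℤ.* ℤ.+ (1 * suc d) ≡ (ℤ.+ a ℤ.* ℤ.+ b) ℤ.* ℤ.+ (suc d)
  cross = cong₂ ℤ._*_ (ℤP.pos-* a b) (cong ℤ.+_ (ℕP.*-identityˡ (suc d)))

÷-≤ : ∀ p q r .{{_ : ℚ.NonZero q}} → 0ℚ ≤ q → p ≤ r ℚ.* q → p ÷ q ≤ r
÷-≤ p q r 0≤q p≤rq = ℚP.*-cancelʳ-≤-pos q {{q>0}} (subst (_≤ r ℚ.* q) (sym ÷-*-cancel) p≤rq)
  where
  q>0 : ℚ.Positive q
  q>0 = ℚP.nonNeg∧nonZero⇒pos q {{ℚ.nonNegative 0≤q}}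
  ÷-*-cancel : p ÷ q ℚ.* q ≡ p
  ÷-*-cancel = trans (ℚP.*-assoc p (ℚ.1/ q) q)
    (trans (cong (p ℚ.*_) (ℚP.*-inverseˡ q)) (ℚP.*-identityʳ p))

-- No positivity hypotheses are needed: fracℕ _ 0 and divℚ _ 0ℚ are both 0ℚ.
divℚ-fracℕ-≤ : ∀ p D m D' r → p * D' ℕ.≤ r * m * D → divℚ (fracℕ p D) (fracℕ m D') ≤ fracℕ r 1
divℚ-fracℕ-≤ p D m zero     r _ = 0≤fracℕ r 1
divℚ-fracℕ-≤ p D m (suc d') r h with fracℕ m (suc d') ℚ.≟ 0ℚ
... | yes _   = 0≤fracℕ r 1
... | no q≢0  = ÷-≤ _ _ _ {{ℚ.≢-nonZero q≢0}} (0≤fracℕ m (suc d'))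
  (subst (fracℕ p D ≤_) (sym (fracℕ-*ˡ r m (suc d'))) (fracℕ-mono p (r * m) D d' h))

sumℚ-fracℕ : ∀ (xs : List A) (f : A → ℚ) (g : A → ℕ) D →
  (∀ x → x ∈ xs → f x ≡ fracℕ (g x) D) → sumℚ (map f xs) ≡ fracℕ (∑ xs g) D
sumℚ-fracℕ []       f g D f≡g = sym (fracℕ-0 D)
sumℚ-fracℕ (x ∷ xs) f g D f≡g =
  trans (cong₂ ℚ._+_ (f≡g x (here refl)) (sumℚ-fracℕ xs f g D (λ y y∈xs → f≡g y (there y∈xs))))
    (fracℕ-+ (g x) (∑ xs g) D)

sumℚ-++ : ∀ xs ys → sumℚ (xs ++ ys) ≡ sumℚ xs ℚ.+ sumℚ ys
sumℚ-++ []       ys = sym (ℚP.+-identityˡ (sumℚ ys))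
sumℚ-++ (x ∷ xs) ys = trans (cong (x ℚ.+_) (sumℚ-++ xs ys)) (sym (ℚP.+-assoc x (sumℚ xs) (sumℚ ys)))

sumℚ-concatMap-fracℕ : ∀ (xs : List A) (fs : A → List ℚ) (g : A → ℕ) D →
  (∀ x → sumℚ (fs x) ≡ fracℕ (g x) D) → sumℚ (concatMap fs xs) ≡ fracℕ (∑ xs g) D
sumℚ-concatMap-fracℕ []       fs g D fs≡g = sym (fracℕ-0 D)
sumℚ-concatMap-fracℕ (x ∷ xs) fs g D fs≡g =
  trans (sumℚ-++ (fs x) (concatMap fs xs))
    (trans (cong₂ ℚ._+_ (fs≡g x) (sumℚ-concatMap-fracℕ xs fs g D fs≡g)) (fracℕ-+ (g x) (∑ xs g) D))

maxℚ-map-≤ : ∀ (xs : List A) (f : A → ℚ) r → 0ℚ ≤ r → (∀ x → x ∈ xs → f x ≤ r) → maxℚ (map f xs) ≤ r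
maxℚ-map-≤ []       f r 0≤r f≤r = 0≤r
maxℚ-map-≤ (x ∷ xs) f r 0≤r f≤r =
  ℚP.⊔-lub (f≤r x (here refl)) (maxℚ-map-≤ xs f r 0≤r (λ y y∈xs → f≤r y (there y∈xs)))

∈⇒≤maxℕ : ∀ {n} xs → n ∈ xs → n ℕ.≤ maxℕ xs
∈⇒≤maxℕ (x ∷ xs) (here refl) = ℕP.m≤m⊔n x (maxℕ xs)
∈⇒≤maxℕ (x ∷ xs) (there n∈xs) = ℕP.≤-trans (∈⇒≤maxℕ xs n∈xs) (ℕP.m≤n⊔m x (maxℕ xs))

module Action (G : FinGroup) where
  open FinGroup G
  open IsGroup isGroup using (inverseˡ; inverseʳ)

  module OnPoints {N} (act : Carrier → Fin N → Fin N) (isAction : IsAction G N act) where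
    act-inverseˡ : ∀ g x → act (g ⁻¹) (act g x) ≡ x
    act-inverseˡ g x =
      trans (sym (proj₂ isAction (g ⁻¹) g x)) (trans (cong (λ h → act h x) (inverseˡ g)) (proj₁ isAction x))

    act-inverseʳ : ∀ g x → act g (act (g ⁻¹) x) ≡ x
    act-inverseʳ g x =
      trans (sym (proj₂ isAction g (g ⁻¹) x)) (trans (cong (λ h → act h x) (inverseʳ g)) (proj₁ isAction x))

    ∑-act : ∀ g (h : Fin N → ℕ) → ∑[ x ← allFin N ] h (act g x) ≡ ∑ (allFin N) h
    ∑-act g = Enumeration.∑-reindex (finEnumeration N) (act g) (act (g ⁻¹)) (act-inverseˡ g) (act-inverseʳ g)

  module OnSubsets {V} (act : Carrier → Fin V → Fin V) (isAction : IsAction G V act) where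
    open OnPoints act isAction

    private
      infixr 25 _·_
      _·_ : Carrier → Subset V → Subset V
      _·_ = actSub G act

    lookup-actSub : ∀ g σ w → lookup (g · σ) w ≡ lookup σ (act (g ⁻¹) w)
    lookup-actSub g σ w = VecP.lookup∘tabulate _ w

    actSub-ε : ∀ σ → ε · σ ≡ σ
    actSub-ε σ = trans (VecP.tabulate-cong (λ w → cong (lookup σ) ε⁻¹-fixes))
      (VecP.tabulate∘lookup σ)
      where
      ε⁻¹-fixes : ∀ {w} → act (ε ⁻¹) w ≡ w
      ε⁻¹-fixes {w} = trans (cong (act (ε ⁻¹)) (sym (proj₁ isAction w))) (act-inverseˡ ε w)

    actSub-inverseˡ : ∀ g σ → (g ⁻¹) · (g · σ) ≡ σ
    actSub-inverseˡ g σ = trans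
      (VecP.tabulate-cong (λ w → trans (lookup-actSub g σ _) (cong (lookup σ) (act-inverseʳ (g ⁻¹) w))))
      (VecP.tabulate∘lookup σ)

    actSub-inverseʳ : ∀ g σ → g · ((g ⁻¹) · σ) ≡ σ
    actSub-inverseʳ g σ = trans
      (VecP.tabulate-cong (λ w → trans (lookup-actSub (g ⁻¹) σ _) (cong (lookup σ) (act-inverseˡ (g ⁻¹) w))))
      (VecP.tabulate∘lookup σ)

    ∑-actSub : ∀ g (h : Subset V → ℕ) → ∑[ σ ← allSubsets V ] h (g · σ) ≡ ∑ (allSubsets V) h
    ∑-actSub g = Enumeration.∑-reindex (subsetEnumeration V) (g ·_) ((g ⁻¹) ·_)
      (actSub-inverseˡ g) (actSub-inverseʳ g)

    ∣actSub∣ : ∀ g σ → ∣ g · σ ∣ ≡ ∣ σ ∣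
    ∣actSub∣ g σ = begin
      ∣ g · σ ∣                                         ≡⟨ ∣ g · σ ∣≡∑ ⟩
      ∑[ w ← allFin V ] [ lookup (g · σ) w ]* 1          ≡⟨ ∑-cong (allFin V) (λ w → cong ([_]* 1) (lookup-actSub g σ w)) ⟩
      ∑[ w ← allFin V ] [ lookup σ (act (g ⁻¹) w) ]* 1   ≡⟨ ∑-act (g ⁻¹) (λ v → [ lookup σ v ]* 1) ⟩
      ∑[ v ← allFin V ] [ lookup σ v ]* 1                ≡⟨ ∣ σ ∣≡∑ ⟨
      ∣ σ ∣                                             ∎
      where open ≡-Reasoning

    actSub-⊆ : ∀ g {τ ρ} → τ ⊆ ρ → g · τ ⊆ g · ρ
    actSub-⊆ g {τ} {ρ} τ⊆ρ {w} w∈gτ =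
      VecP.lookup⇒[]= w (g · ρ) (trans (lookup-actSub g ρ w) (VecP.[]=⇒lookup (τ⊆ρ g⁻¹w∈τ)))
      where
      g⁻¹w∈τ : τ [ act (g ⁻¹) w ]= inside
      g⁻¹w∈τ = VecP.lookup⇒[]= _ τ (trans (sym (lookup-actSub g τ w)) (VecP.[]=⇒lookup w∈gτ))

    actSub-⊆ᵇ : ∀ g τ ρ → (g · τ ⊆ᵇ g · ρ) ≡ (τ ⊆ᵇ ρ)
    actSub-⊆ᵇ g τ ρ = does-⇔ (mk⇔ reflect (actSub-⊆ g)) (g · τ ⊆? g · ρ) (τ ⊆? ρ)
      where
      reflect : g · τ ⊆ g · ρ → τ ⊆ ρ
      reflect gτ⊆gρ = subst₂ _⊆_ (actSub-inverseˡ g τ) (actSub-inverseˡ g ρ) (actSub-⊆ (g ⁻¹) gτ⊆gρ)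

    inOrbit-sound : ∀ η η' → inOrbit G act η η' ≡ true → Σ Carrier (λ g → g · η ≡ η')
    inOrbit-sound η η' orb
      with g , g·η≟η' ← Any.satisfied (AnyP.any⁻ _ elems (Equivalence.from T-≡ orb))
      with VecP.≡-dec Bool._≟_ (g · η) η'
    ... | yes g·η≡η' = g , g·η≡η'

    inOrbit-complete : ∀ η g → inOrbit G act η (g · η) ≡ true
    inOrbit-complete η g = Equivalence.to T-≡
      (AnyP.any⁺ _ (Any.map (λ { refl → Equivalence.from T-≡ g·η≟g·η }) (complete g)))
      where
      g·η≟g·η : (g · η ≟ˢ g · η) ≡ true
      g·η≟g·η = dec-true (VecP.≡-dec Bool._≟_ (g · η) (g · η)) refl

    ∣orbit∣ : Subset V → ℕ
    ∣orbit∣ η = ∑[ η' ← allSubsets V ] [ inOrbit G act η η' ]* 1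

    1≤∣orbit∣ : ∀ η → 1 ℕ.≤ ∣orbit∣ η
    1≤∣orbit∣ η = subst (ℕ._≤ ∣orbit∣ η) (cong ([_]* 1) η∈Gη)
      (∑-∈ (λ η' → [ inOrbit G act η η' ]* 1) (allSubsets-complete η))
      where
      η∈Gη : inOrbit G act η η ≡ true
      η∈Gη = subst (λ η' → inOrbit G act η η' ≡ true) (actSub-ε η) (inOrbit-complete η ε)

    ∑-orbit : (f : Subset V → ℕ) → (∀ g σ → f (g · σ) ≡ f σ) → ∀ η →
      ∑[ η' ← allSubsets V ] [ inOrbit G act η η' ]* f η' ≡ f η * ∣orbit∣ η
    ∑-orbit f f-invariant η = trans (∑-cong (allSubsets V) constant-on-orbit) (∑-*ˡ (allSubsets V) (f η) _)
      where
      constant-on-orbit : ∀ η' → [ inOrbit G act η η' ]* f η' ≡ f η * [ inOrbit G act η η' ]* 1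
      constant-on-orbit η' with inOrbit G act η η' in orb
      ... | false = sym (ℕP.*-zeroʳ (f η))
      ... | true with g , refl ← inOrbit-sound η η' orb =
        trans (f-invariant g η) (sym (ℕP.*-identityʳ (f η)))

isFace : ∀ {V} → Complex V → ℕ → Subset V → Bool
isFace K j σ = K σ ∧ (∣ σ ∣ ≡ᵇ j)

isFace⇒ : ∀ {V} (K : Complex V) j σ → isFace K j σ ≡ true → K σ ≡ true × ∣ σ ∣ ≡ j
isFace⇒ K j σ σ∈K with K σ | σ∈K
... | true | ∣σ∣≡ᵇj = refl , ℕP.≡ᵇ⇒≡ ∣ σ ∣ j (Equivalence.from T-≡ ∣σ∣≡ᵇj)

∈-facesOfSize : ∀ {V} (K : Complex V) {j σ} → isFace K j σ ≡ true → σ ∈ facesOfSize K j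
∈-facesOfSize K {j} {σ} σ∈K =
  ∈P.∈-filter⁺ (Bool.T? ∘ isFace K j) (allSubsets-complete σ) (Equivalence.from T-≡ σ∈K)

∈-facesOfSize⁻ : ∀ {V} (K : Complex V) {j σ} → σ ∈ facesOfSize K j → isFace K j σ ≡ true
∈-facesOfSize⁻ K {j} σ∈K = Equivalence.to T-≡ (proj₂ (∈P.∈-filter⁻ (Bool.T? ∘ isFace K j) {xs = allSubsets _} σ∈K))

module Cofaces {V} (X : Complex V) (n : ℕ) where
  open Weights X n using (fₙ; cnt)

  cofaces : Subset V → ℕ
  cofaces σ = ∑[ ρ ← allSubsets V ] [ isFace X (suc n) ρ ]* [ σ ⊆ᵇ ρ ]* 1

  fₙ≡∑ : fₙ ≡ ∑[ ρ ← allSubsets V ] [ isFace X (suc n) ρ ]* 1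
  fₙ≡∑ = length-filterᵇ (isFace X (suc n)) (allSubsets V)

  cnt≡cofaces : ∀ σ → cnt σ ≡ cofaces σ
  cnt≡cofaces σ = trans (length-filterᵇ (σ ⊆ᵇ_) (facesOfSize X (suc n)))
    (∑-filterᵇ (isFace X (suc n)) (allSubsets V) (λ ρ → [ σ ⊆ᵇ ρ ]* 1))

  ∑-cofaces≤ : ∀ j → ∑[ τ ← allSubsets V ] [ isFace X j τ ]* cofaces τ ℕ.≤ (suc n C j) * fₙ
  ∑-cofaces≤ j = begin
    ∑[ τ ← L ] [ isFace X j τ ]* cofaces τ
      ≤⟨ ∑-mono L (λ τ → ℕP.≤-trans (ℕP.≤-reflexive ([]*-∧ (X τ) _ _)) ([]*-≤ (X τ) _)) ⟩
    ∑[ τ ← L ] [ ∣ τ ∣ ≡ᵇ j ]* cofaces τ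
      ≡⟨ ∑-comm-[]* L L (λ τ → ∣ τ ∣ ≡ᵇ j) (isFace X (suc n)) (λ τ ρ → [ τ ⊆ᵇ ρ ]* 1) ⟩
    ∑[ ρ ← L ] [ isFace X (suc n) ρ ]* (∑[ τ ← L ] [ ∣ τ ∣ ≡ᵇ j ]* [ τ ⊆ᵇ ρ ]* 1)
      ≡⟨ ∑-cong L j-faces-of-facet ⟩
    ∑[ ρ ← L ] (suc n C j) * [ isFace X (suc n) ρ ]* 1
      ≡⟨ ∑-*ˡ L (suc n C j) _ ⟩
    (suc n C j) * (∑[ ρ ← L ] [ isFace X (suc n) ρ ]* 1)
      ≡⟨ cong ((suc n C j) *_) fₙ≡∑ ⟨
    (suc n C j) * fₙ ∎
    where
    open ℕP.≤-Reasoning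
    L = allSubsets V
    j-faces-of-facet : ∀ ρ → [ isFace X (suc n) ρ ]* (∑[ τ ← L ] [ ∣ τ ∣ ≡ᵇ j ]* [ τ ⊆ᵇ ρ ]* 1)
                           ≡ (suc n C j) * [ isFace X (suc n) ρ ]* 1
    j-faces-of-facet ρ with isFace X (suc n) ρ in ρ∈X
    ... | false = sym (ℕP.*-zeroʳ (suc n C j))
    ... | true  = trans (∑-subsets-of-size ρ j)
      (trans (cong (_C j) (proj₂ (isFace⇒ X (suc n) ρ ρ∈X))) (sym (ℕP.*-identityʳ (suc n C j))))

∈-concatMap⁺-∈ : ∀ (f : A → List B) {x y xs} → x ∈ xs → y ∈ f x → y ∈ concatMap f xs
∈-concatMap⁺-∈ f x∈xs y∈fx = ∈P.∈-concatMap⁺ f (Any.map (λ { refl → y∈fx }) x∈xs)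

module BuildingLikeBound
  {V n m : ℕ} {X : Complex V} {G : FinGroup}
  {act : FinGroup.Carrier G → Fin V → Fin V}
  {actS : FinGroup.Carrier G → Fin m → Fin m}
  {B : Fin m → Subset V → Complex V}
  {c : Fin m → Subset V → Chain V}
  (in-facet : ∀ σ → X σ ≡ true → Σ _ (λ ρ → X ρ ≡ true × ∣ ρ ∣ ≡ suc n × σ ⊆ ρ))
  (aut : IsAutSubgroup G X act)
  (actS-isAction : IsAction G m actS)
  (transitive : ∀ ρ ρ' → X ρ ≡ true → ∣ ρ ∣ ≡ suc n → X ρ' ≡ true → ∣ ρ' ∣ ≡ suc n →
                  Σ (FinGroup.Carrier G) (λ g → actSub G act g ρ ≡ ρ'))
  (equivariant : ∀ g s τ σ → X τ ≡ true → ∣ τ ∣ ℕ.≤ n →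
                   B (actS g s) (actSub G act g τ) (actSub G act g σ) ≡ B s τ σ)
  (c⊆B : ∀ s τ → X τ ≡ true → ∣ τ ∣ ℕ.≤ n → ∀ σ → c s τ σ ≡ true → B s τ σ ≡ true)
  (k : ℕ) (k<n : k < n)
  where

  open FinGroup G using (Carrier)
  open Action G
  open OnSubsets act (proj₁ aut)
  open Cofaces X n
  open Weights X n using (fₙ; cnt; w)

  private
    L = allSubsets V
    infixr 25 _·_
    _·_ : Carrier → Subset V → Subset V
    _·_ = actSub G act
    _∈G·_ : Subset V → Subset V → Bool
    η' ∈G· η = inOrbit G act η η'
    Xₖ Xₖ₊₁ Xₙ : Subset V → Bool
    Xₖ   = isFace X (suc k)
    Xₖ₊₁ = isFace X (suc (suc k))
    Xₙ   = isFace X (suc n)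
    Kₖ Kₖ₊₁ : ℕ
    Kₖ   = suc n C suc k
    Kₖ₊₁ = suc n C suc (suc k)

  isFace-invariant : ∀ g j σ → isFace X j (g · σ) ≡ isFace X j σ
  isFace-invariant g j σ rewrite proj₂ (proj₂ aut) g σ | ∣actSub∣ g σ = refl

  cofaces-invariant : ∀ g σ → cofaces (g · σ) ≡ cofaces σ
  cofaces-invariant g σ = trans (sym (∑-actSub g _)) (∑-cong L (λ ρ →
    cong₂ (λ b b' → [ b ]* [ b' ]* 1) (isFace-invariant g (suc n) ρ) (actSub-⊆ᵇ g σ ρ)))

  face-admissible : ∀ {τ} → Xₖ τ ≡ true → X τ ≡ true × ∣ τ ∣ ℕ.≤ n
  face-admissible {τ} τ∈X with isFace⇒ X (suc k) τ τ∈X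
  ... | τ∈X′ , ∣τ∣≡1+k = τ∈X′ , subst (ℕ._≤ n) (sym ∣τ∣≡1+k) k<n

  -- coverWeight is W of the header; supportWeight is C(n+1,k+1)·fₙ times the numerator of λ.
  coverWeight supportWeight : Subset V → ℕ
  coverWeight   η = ∑[ s ← allFin m ] ∑[ τ ← L ] [ Xₖ τ ]* [ B s τ η ]* cofaces τ
  supportWeight η = ∑[ s ← allFin m ] ∑[ τ ← L ] [ Xₖ τ ]* [ c s τ η ]* cofaces τ

  supportWeight≤coverWeight : ∀ η → supportWeight η ℕ.≤ coverWeight η
  supportWeight≤coverWeight η = ∑-mono (allFin m) (λ s → ∑-mono L (c-within-B s))
    where
    c-within-B : ∀ s τ → [ Xₖ τ ]* [ c s τ η ]* cofaces τ ℕ.≤ [ Xₖ τ ]* [ B s τ η ]* cofaces τ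
    c-within-B s τ with Xₖ τ in τ∈Xₖ
    ... | false = z≤n
    ... | true with τ∈X , ∣τ∣≤n ← face-admissible τ∈Xₖ = []*-mono-⇒ (cofaces τ) (c⊆B s τ τ∈X ∣τ∣≤n η)

  coverWeight-invariant : ∀ g η → coverWeight (g · η) ≡ coverWeight η
  coverWeight-invariant g η = begin
    ∑[ s ← allFin m ] ∑[ τ ← L ] [ Xₖ τ ]* [ B s τ (g · η) ]* cofaces τ
      ≡⟨ OnPoints.∑-act actS actS-isAction g _ ⟨
    ∑[ s ← allFin m ] ∑[ τ ← L ] [ Xₖ τ ]* [ B (actS g s) τ (g · η) ]* cofaces τ
      ≡⟨ ∑-cong (allFin m) (λ s → ∑-actSub g _) ⟨
    ∑[ s ← allFin m ] ∑[ τ ← L ] [ Xₖ (g · τ) ]* [ B (actS g s) (g · τ) (g · η) ]* cofaces (g · τ)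
      ≡⟨ ∑-cong (allFin m) (λ s → ∑-cong L (translate s)) ⟩
    ∑[ s ← allFin m ] ∑[ τ ← L ] [ Xₖ τ ]* [ B s τ η ]* cofaces τ ∎
    where
    open ≡-Reasoning
    translate : ∀ s τ → [ Xₖ (g · τ) ]* [ B (actS g s) (g · τ) (g · η) ]* cofaces (g · τ)
                      ≡ [ Xₖ τ ]* [ B s τ η ]* cofaces τ
    translate s τ rewrite isFace-invariant g (suc k) τ | cofaces-invariant g τ with Xₖ τ in τ∈Xₖ
    ... | false = refl
    ... | true with τ∈X , ∣τ∣≤n ← face-admissible τ∈Xₖ =
      cong ([_]* cofaces τ) (equivariant g s τ η τ∈X ∣τ∣≤n)

  aₖ : ℕ
  aₖ = Weights.aₖ X n G act m B k

  orbit∩B : Subset V → Fin m → Subset V → ℕ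
  orbit∩B η s τ = ∑[ η' ← L ] [ η' ∈G· η ]* [ B s τ η' ]* 1

  orbit∩B≤aₖ : ∀ η s τ → Xₖ₊₁ η ≡ true → Xₖ τ ≡ true →
    orbit∩B η s τ ℕ.≤ aₖ
  orbit∩B≤aₖ η s τ η∈X τ∈X = begin
    orbit∩B η s τ
      ≡⟨ ∑-cong L orbit-has-size-k+2 ⟩
    ∑[ η' ← L ] [ isFace (B s τ) (suc (suc k)) η' ]* [ η' ∈G· η ]* 1
      ≡⟨ ∑-filterᵇ (isFace (B s τ) (suc (suc k))) L _ ⟨
    ∑[ η' ← facesOfSize (B s τ) (suc (suc k)) ] [ η' ∈G· η ]* 1
      ≡⟨ length-filterᵇ (_∈G· η) (facesOfSize (B s τ) (suc (suc k))) ⟨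
    length (filterᵇ (_∈G· η) (facesOfSize (B s τ) (suc (suc k))))
      ≤⟨ ∈⇒≤maxℕ _ (∈-concatMap⁺-∈ _ (∈-facesOfSize X η∈X)
                     (∈-concatMap⁺-∈ _ (∈P.∈-allFin s) (∈P.∈-map⁺ _ (∈-facesOfSize X τ∈X)))) ⟩
    aₖ ∎
    where
    open ℕP.≤-Reasoning
    orbit-has-size-k+2 : ∀ η' → [ η' ∈G· η ]* [ B s τ η' ]* 1
                              ≡ [ isFace (B s τ) (suc (suc k)) η' ]* [ η' ∈G· η ]* 1
    orbit-has-size-k+2 η' with η' ∈G· η in orb
    ... | false = sym ([]*-0 _)
    ... | true with g , refl ← inOrbit-sound η η' orb =
      sym (trans (cong (λ b → [ B s τ (g · η) ∧ b ]* 1) ∣gη∣≡k+2) (cong ([_]* 1) (∧-identityʳ _)))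
      where
      ∣gη∣≡k+2 : (∣ g · η ∣ ≡ᵇ suc (suc k)) ≡ true
      ∣gη∣≡k+2 = Equivalence.to T-≡
        (ℕP.≡⇒≡ᵇ _ _ (trans (∣actSub∣ g η) (proj₂ (isFace⇒ X (suc (suc k)) η η∈X))))

  ∑-orbit-coverWeight : ∀ η → ∑[ η' ← L ] [ η' ∈G· η ]* coverWeight η'
    ≡ ∑[ s ← allFin m ] ∑[ τ ← L ] [ Xₖ τ ]* (cofaces τ * orbit∩B η s τ)
  ∑-orbit-coverWeight η = begin
    ∑[ η' ← L ] [ η' ∈G· η ]* coverWeight η'
      ≡⟨ ∑-cong L (λ η' → []*-∑ (η' ∈G· η) (allFin m) _) ⟩
    ∑[ η' ← L ] ∑[ s ← allFin m ] [ η' ∈G· η ]* (∑[ τ ← L ] [ Xₖ τ ]* [ B s τ η' ]* cofaces τ)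
      ≡⟨ ∑-comm L (allFin m) _ ⟩
    ∑[ s ← allFin m ] ∑[ η' ← L ] [ η' ∈G· η ]* (∑[ τ ← L ] [ Xₖ τ ]* [ B s τ η' ]* cofaces τ)
      ≡⟨ ∑-cong (allFin m) (λ s → ∑-comm-[]* L L (_∈G· η) Xₖ (λ η' τ → [ B s τ η' ]* cofaces τ)) ⟩
    ∑[ s ← allFin m ] ∑[ τ ← L ] [ Xₖ τ ]* (∑[ η' ← L ] [ η' ∈G· η ]* [ B s τ η' ]* cofaces τ)
      ≡⟨ ∑-cong (allFin m) (λ s → ∑-cong L (λ τ → cong [ Xₖ τ ]*_ (factor-cofaces s τ))) ⟩
    ∑[ s ← allFin m ] ∑[ τ ← L ] [ Xₖ τ ]* (cofaces τ * orbit∩B η s τ) ∎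
    where
    open ≡-Reasoning
    factor-cofaces : ∀ s τ → ∑[ η' ← L ] [ η' ∈G· η ]* [ B s τ η' ]* cofaces τ ≡ cofaces τ * orbit∩B η s τ
    factor-cofaces s τ = trans
      (∑-cong L (λ η' → trans (cong [ η' ∈G· η ]*_ ([]*1-*ʳ (B s τ η') (cofaces τ)))
                              ([]*-*ˡ (η' ∈G· η) (cofaces τ) _)))
      (∑-*ˡ L (cofaces τ) _)

  ∑-orbit-coverWeight≤ : ∀ η → Xₖ₊₁ η ≡ true →
    ∑[ η' ← L ] [ η' ∈G· η ]* coverWeight η' ℕ.≤ m * (aₖ * (Kₖ * fₙ))
  ∑-orbit-coverWeight≤ η η∈X = begin
    ∑[ η' ← L ] [ η' ∈G· η ]* coverWeight η'
      ≡⟨ ∑-orbit-coverWeight η ⟩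
    ∑[ s ← allFin m ] ∑[ τ ← L ] [ Xₖ τ ]* (cofaces τ * orbit∩B η s τ)
      ≤⟨ ∑-mono (allFin m) (λ s → ∑-mono L (λ τ → bound s τ)) ⟩
    ∑[ s ← allFin m ] ∑[ τ ← L ] aₖ * [ Xₖ τ ]* cofaces τ
      ≡⟨ ∑-cong (allFin m) (λ s → ∑-*ˡ L aₖ _) ⟩
    ∑[ s ← allFin m ] aₖ * (∑[ τ ← L ] [ Xₖ τ ]* cofaces τ)
      ≡⟨ ∑-const (allFin m) _ ⟩
    length (allFin m) * (aₖ * (∑[ τ ← L ] [ Xₖ τ ]* cofaces τ))
      ≡⟨ cong (_* (aₖ * (∑[ τ ← L ] [ Xₖ τ ]* cofaces τ))) (length-tabulate {n = m} (λ s → s)) ⟩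
    m * (aₖ * (∑[ τ ← L ] [ Xₖ τ ]* cofaces τ))
      ≤⟨ ℕP.*-monoʳ-≤ m (ℕP.*-monoʳ-≤ aₖ (∑-cofaces≤ (suc k))) ⟩
    m * (aₖ * (Kₖ * fₙ)) ∎
    where
    open ℕP.≤-Reasoning
    bound : ∀ s τ → [ Xₖ τ ]* (cofaces τ * orbit∩B η s τ) ℕ.≤ aₖ * [ Xₖ τ ]* cofaces τ
    bound s τ with Xₖ τ in τ∈X
    ... | false = z≤n
    ... | true  = ℕP.≤-trans (ℕP.*-monoʳ-≤ (cofaces τ) (orbit∩B≤aₖ η s τ η∈X τ∈X))
                    (ℕP.≤-reflexive (ℕP.*-comm (cofaces τ) aₖ))

  facet-meets-orbit : ∀ η ρ → X η ≡ true → Xₙ ρ ≡ true →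
    1 ℕ.≤ ∑[ η' ← L ] [ η' ∈G· η ]* [ η' ⊆ᵇ ρ ]* 1
  facet-meets-orbit η ρ η∈X ρ∈X
    with ρ₀ , ρ₀∈X , ∣ρ₀∣≡1+n , η⊆ρ₀ ← in-facet η η∈X
    with ρ∈X′ , ∣ρ∣≡1+n ← isFace⇒ X (suc n) ρ ρ∈X
    with g , gρ₀≡ρ ← transitive ρ₀ ρ ρ₀∈X ∣ρ₀∣≡1+n ρ∈X′ ∣ρ∣≡1+n =
    ℕP.≤-trans (ℕP.≤-reflexive (sym gη-counted))
      (∑-∈ (λ η' → [ η' ∈G· η ]* [ η' ⊆ᵇ ρ ]* 1) (allSubsets-complete (g · η)))
    where
    gη⊆ρ : (g · η ⊆ᵇ ρ) ≡ true
    gη⊆ρ = dec-true (g · η ⊆? ρ) (subst (g · η ⊆_) gρ₀≡ρ (actSub-⊆ g η⊆ρ₀))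
    gη-counted : [ g · η ∈G· η ]* [ g · η ⊆ᵇ ρ ]* 1 ≡ 1
    gη-counted rewrite inOrbit-complete η g | gη⊆ρ = refl

  fₙ≤cofaces*∣orbit∣ : ∀ η → X η ≡ true → fₙ ℕ.≤ cofaces η * ∣orbit∣ η
  fₙ≤cofaces*∣orbit∣ η η∈X = begin
    fₙ
      ≡⟨ fₙ≡∑ ⟩
    ∑[ ρ ← L ] [ Xₙ ρ ]* 1
      ≤⟨ ∑-mono L facet-term ⟩
    ∑[ ρ ← L ] [ Xₙ ρ ]* (∑[ η' ← L ] [ η' ∈G· η ]* [ η' ⊆ᵇ ρ ]* 1)
      ≡⟨ ∑-comm-[]* L L Xₙ (_∈G· η) (λ ρ η' → [ η' ⊆ᵇ ρ ]* 1) ⟩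
    ∑[ η' ← L ] [ η' ∈G· η ]* cofaces η'
      ≡⟨ ∑-orbit cofaces cofaces-invariant η ⟩
    cofaces η * ∣orbit∣ η ∎
    where
    open ℕP.≤-Reasoning
    facet-term : ∀ ρ → [ Xₙ ρ ]* 1 ℕ.≤ [ Xₙ ρ ]* (∑[ η' ← L ] [ η' ∈G· η ]* [ η' ⊆ᵇ ρ ]* 1)
    facet-term ρ with Xₙ ρ in ρ∈X
    ... | false = z≤n
    ... | true  = facet-meets-orbit η ρ η∈X ρ∈X

  supportWeight≤ : ∀ η → Xₖ₊₁ η ≡ true →
    supportWeight η ℕ.≤ m * (aₖ * (Kₖ * cofaces η))
  supportWeight≤ η η∈X = ℕP.≤-trans (supportWeight≤coverWeight η)
    (ℕP.*-cancelˡ-≤ (∣orbit∣ η) {{ℕ.>-nonZero (1≤∣orbit∣ η)}} (begin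
      ∣orbit∣ η * coverWeight η
        ≡⟨ ℕP.*-comm (∣orbit∣ η) _ ⟩
      coverWeight η * ∣orbit∣ η
        ≡⟨ ∑-orbit coverWeight coverWeight-invariant η ⟨
      ∑[ η' ← L ] [ η' ∈G· η ]* coverWeight η'
        ≤⟨ ∑-orbit-coverWeight≤ η η∈X ⟩
      m * (aₖ * (Kₖ * fₙ))
        ≤⟨ ℕP.*-monoʳ-≤ m (ℕP.*-monoʳ-≤ aₖ (ℕP.*-monoʳ-≤ Kₖ (fₙ≤cofaces*∣orbit∣ η η∈X′))) ⟩
      m * (aₖ * (Kₖ * (cofaces η * ∣orbit∣ η)))
        ≡⟨ rearrange m aₖ Kₖ (cofaces η) (∣orbit∣ η) ⟩
      ∣orbit∣ η * (m * (aₖ * (Kₖ * cofaces η))) ∎))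
    where
    open ℕP.≤-Reasoning
    η∈X′ = proj₁ (isFace⇒ X (suc (suc k)) η η∈X)
    rearrange : ∀ m a K x o → m * (a * (K * (x * o))) ≡ o * (m * (a * (K * x)))
    rearrange = solve-∀

  lam≤ : ∀ η → Xₖ₊₁ η ≡ true → Weights.lam X n m c k η ≤ fracℕ (Kₖ₊₁ * aₖ) 1
  lam≤ η η∈X = subst₂ (λ p q → divℚ p q ≤ fracℕ (Kₖ₊₁ * aₖ) 1) (sym numerator) (sym denominator)
    (divℚ-fracℕ-≤ (supportWeight η) (Kₖ * fₙ) (m * cofaces η) (Kₖ₊₁ * fₙ) (Kₖ₊₁ * aₖ) cross-multiplied)
    where
    w≡ : ∀ σ {j} → ∣ σ ∣ ≡ j → w σ ≡ fracℕ (cofaces σ) ((suc n C j) * fₙ)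
    w≡ σ ∣σ∣≡j = cong₂ fracℕ (cnt≡cofaces σ) (cong (λ j → (suc n C j) * fₙ) ∣σ∣≡j)
    supported : Fin m → List (Subset V)
    supported s = filterᵇ (λ τ → c s τ η) (facesOfSize X (suc k))
    ∣supported∣ : ∀ s τ → τ ∈ supported s → ∣ τ ∣ ≡ suc k
    ∣supported∣ s τ τ∈ = proj₂ (isFace⇒ X (suc k) τ (∈-facesOfSize⁻ X
      (proj₁ (∈P.∈-filter⁻ (Bool.T? ∘ (λ τ → c s τ η)) {xs = facesOfSize X (suc k)} τ∈))))
    numerator : sumℚ (concatMap (λ s → map w (supported s)) (allFin m)) ≡ fracℕ (supportWeight η) (Kₖ * fₙ)
    numerator = sumℚ-concatMap-fracℕ (allFin m) _ _ (Kₖ * fₙ) λ s →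
      trans (sumℚ-fracℕ (supported s) w cofaces (Kₖ * fₙ) (λ τ τ∈ → w≡ τ (∣supported∣ s τ τ∈)))
        (cong (λ t → fracℕ t (Kₖ * fₙ))
          (trans (∑-filterᵇ (λ τ → c s τ η) (facesOfSize X (suc k)) cofaces) (∑-filterᵇ Xₖ L _)))
    denominator : fracℕ m 1 ℚ.* w η ≡ fracℕ (m * cofaces η) (Kₖ₊₁ * fₙ)
    denominator = trans (cong (fracℕ m 1 ℚ.*_) (w≡ η (proj₂ (isFace⇒ X (suc (suc k)) η η∈X))))
      (fracℕ-*ˡ m (cofaces η) (Kₖ₊₁ * fₙ))
    rearrange : ∀ m a K x K′ f → m * (a * (K * x)) * (K′ * f) ≡ K′ * a * (m * x) * (K * f)
    rearrange = solve-∀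
    cross-multiplied : supportWeight η * (Kₖ₊₁ * fₙ) ℕ.≤ Kₖ₊₁ * aₖ * (m * cofaces η) * (Kₖ * fₙ)
    cross-multiplied = ℕP.≤-trans (ℕP.*-monoˡ-≤ (Kₖ₊₁ * fₙ) (supportWeight≤ η η∈X))
      (ℕP.≤-reflexive (rearrange m aₖ Kₖ (cofaces η) Kₖ₊₁ fₙ))

  θ≤ : Weights.θ X n m c k ≤ fracℕ (Kₖ₊₁ * aₖ) 1
  θ≤ = maxℚ-map-≤ (facesOfSize X (suc (suc k))) _ _ (0≤fracℕ (Kₖ₊₁ * aₖ) 1)
    (λ η η∈ → lam≤ η (∈-facesOfSize⁻ X η∈))

claim2p4 : (V n m : ℕ) (X : Complex V) (G : FinGroup)
    (act : FinGroup.Carrier G → Fin V → Fin V)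
    (actS : FinGroup.Carrier G → Fin m → Fin m)
    (B : Fin m → Subset V → Complex V)
    (c : Fin m → Subset V → Chain V) →
    IsBuildingLike X n G act m actS B →
    IsChainFamily X n m B c →
    (k : ℕ) → k < n →
    Weights.θ X n m c k ≤ fracℕ ((suc n C suc (suc k)) * Weights.aₖ X n G act m B k) 1
claim2p4 V n m X G act actS B c
  ((_ , _ , in-facet) , aut , actS-isAction , _ , _ , transitive , equivariant , _) chain k k<n =
  BuildingLikeBound.θ≤ {G = G} in-facet aut actS-isAction transitive equivariant c⊆B k k<n
  where
  c⊆B : ∀ s τ → X τ ≡ true → ∣ τ ∣ ℕ.≤ n → ∀ σ → c s τ σ ≡ true → B s τ σ ≡ true
  c⊆B s τ τ∈X ∣τ∣≤n σ σ∈c = proj₁ (proj₁ (chain s τ τ∈X ∣τ∣≤n) σ σ∈c)
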